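{- Let $x,y\in\mathbb{N}\setminus\{1\}$. If $\phi(y)\le\phi(x)$ and $y>x$, then $D(W(y),W(x))<1$.
   Context: $\phi$ is Euler's totient function; $W(x)$ denotes the set of prime divisors of $x$. For finite sets $A,B$ of primes, $D(A,B)=\left(\prod_{q\in A}\frac{q-1}{q}\right)\left(\prod_{q\in B}\frac{q}{q-1}\right)$. -}

module Defs where

open import Data.Nat using (ℕ; zero; suc; _∸_)
open import Data.Nat.Divisibility using (_∣?_)
open import Data.Nat.Primality using (prime?)
open import Data.Nat.Coprimality using (coprime?)
open import Data.List using (List; []; _∷_; filter; upTo; map; length)
open import Data.Integer using (+_)
open import Data.Rational using (ℚ; _/_; 0ℚ; 1ℚ; _*_)
open import Relation.Nullary.Decidable using (_×-dec_)

φ : ℕ → ℕ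
φ n = length (filter (λ k → coprime? k n) (map suc (upTo n)))

-- W x : the (finite) set of prime divisors of x, as a duplicate-free list
-- (primes p with p ≤ x and p ∣ x; for x ≥ 1 every prime divisor is ≤ x)
W : ℕ → List ℕ
W x = filter (λ p → prime? p ×-dec (p ∣? x)) (upTo (suc x))

-- the rational number a / b (convention: 0 when b = 0; never used for primes)
frac : ℕ → ℕ → ℚ
frac a zero    = 0ℚ
frac a (suc b) = (+ a) / suc b

prodA : List ℕ → ℚ
prodA []      = 1ℚ
prodA (q ∷ A) = frac (q ∸ 1) q * prodA A

prodB : List ℕ → ℚ
prodB []      = 1ℚ
prodB (q ∷ B) = frac q (q ∸ 1) * prodB B

D : List ℕ → List ℕ → ℚ
D A B = prodA A * prodB B

{-# OPTIONS --safe #-}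
module Submission where

-- Legendre's sieve: the k ≤ M·∏P prime to every element of a set P of primes number
-- M·∏_{p∈P}(p − 1), because those prime to p ∷ P are the ones prime to P (counted at p·M)
-- minus the multiples p·j with j ≤ M·∏P prime to P (counted at M).  For P = W n and
-- M = n/∏P this is φ n·∏_{p∣n} p = n·∏_{p∣n}(p − 1), whence
-- D(W y, W x) = (φ y/y)(x/φ x) ≤ x/y < 1.

open import Defs
open import Data.Bool using (Bool; true; false; not; _∧_)
open import Data.Nat hiding (_/_)
open import Data.Nat.Properties
open import Algebra.Properties.CommutativeSemigroup +-commutativeSemigroup using (interchange)
open import Algebra.Properties.CommutativeSemigroup *-commutativeSemigroup
  using (x∙yz≈y∙xz; x∙yz≈yx∙z; xy∙z≈xz∙y; xy∙z≈x∙zy)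
open import Data.Nat.Divisibility
open import Data.Nat.Coprimality using (Coprime; coprime?; coprime-divisor)
open import Data.Nat.ListAction using (product)
open import Data.Nat.ListAction.Properties using (product≢0)
open import Data.Nat.Primality
open import Data.Nat.Primality.Factorisation using (factorise; factorisationHasAllPrimeFactors)
open import Data.List using (List; []; _∷_; [_]; _++_; _∷ʳ_; map; filter; length; upTo)
open import Data.List.Properties using (upTo-∷ʳ; map-++; filter-++; length-++)
open import Data.List.Membership.Propositional using (_∈_)
open import Data.List.Membership.Propositional.Properties using (∈-filter⁺; ∈-upTo⁺)
open import Data.List.Relation.Unary.All as All using (All; []; _∷_; all?)
open import Data.List.Relation.Unary.All.Properties using (all-filter; map⁺)
open import Data.List.Relation.Unary.AllPairs using ([]; _∷_)
open import Data.List.Relation.Unary.Unique.Propositional using (Unique)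
import Data.List.Relation.Unary.Unique.Propositional.Properties as Unique
open import Data.Empty using (⊥-elim)
open import Data.Integer as ℤ using (+_; +<+)
open import Data.Integer.Properties as ℤ using (pos-*)
open import Data.Rational as ℚ using (1ℚ; toℚᵘ) renaming (_<_ to _<ℚ_)
open import Data.Rational.Properties using (toℚᵘ-fromℚᵘ; toℚᵘ-homo-*; toℚᵘ-cancel-<)
open import Data.Rational.Unnormalised as ℚᵘ using (mkℚᵘ; _≃_; *<*; _/_)
open import Data.Rational.Unnormalised.Properties as ℚᵘ
  using (≃-refl; ≃-sym; ≃-trans; ≃-reflexive; <-respˡ-≃)
open import Data.Product using (_×_; _,_; ∃; proj₁; proj₂)
open import Data.Sum using (inj₁; inj₂)
open import Function using (_∘_; case_of_)
open import Function.Bundles using (mk⇔)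
open import Relation.Nullary using (does; ¬_; ¬?)
open import Relation.Nullary.Decidable using (dec-true; dec-false; does-⇔; _×-dec_)
open import Level using (0ℓ)
open import Relation.Unary using (Pred; Decidable)
open import Relation.Binary.PropositionalEquality hiding ([_])

toℕ : Bool → ℕ
toℕ false = 0
toℕ true  = 1

count : (ℕ → Bool) → ℕ → ℕ
count f zero    = 0
count f (suc n) = count f n + toℕ (f (suc n))

count-cong : ∀ {f g} n → (∀ k → f k ≡ g k) → count f n ≡ count g n
count-cong zero    f≗g = refl
count-cong (suc n) f≗g = cong₂ _+_ (count-cong n f≗g) (cong toℕ (f≗g (suc n)))

count-true : ∀ n → count (λ _ → true) n ≡ n
count-true zero    = refl
count-true (suc n) = trans (cong (_+ 1) (count-true n)) (+-comm n 1)

count-split : ∀ (d f : ℕ → Bool) n →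
              count f n ≡ count (λ k → not (d k) ∧ f k) n + count (λ k → d k ∧ f k) n
count-split d f zero    = refl
count-split d f (suc n) =
  trans (cong₂ _+_ (count-split d f n) (toℕ-split (d (suc n)) (f (suc n))))
        (interchange (count (λ k → not (d k) ∧ f k) n) (count (λ k → d k ∧ f k) n) _ _)
  where
  toℕ-split : ∀ a b → toℕ b ≡ toℕ (not a ∧ b) + toℕ (a ∧ b)
  toℕ-split true  b     = refl
  toℕ-split false false = refl
  toℕ-split false true  = refl

count-+ : ∀ f m n → count f (m + n) ≡ count f m + count (λ i → f (m + i)) n
count-+ f m zero    = trans (cong (count f) (+-identityʳ m)) (sym (+-identityʳ _))
count-+ f m (suc n) = begin
  count f (m + suc n)
    ≡⟨ cong (count f) (+-suc m n) ⟩
  count f (m + n) + toℕ (f (suc (m + n)))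
    ≡⟨ cong (_+ toℕ (f (suc (m + n)))) (count-+ f m n) ⟩
  count f m + count (λ i → f (m + i)) n + toℕ (f (suc (m + n)))
    ≡⟨ +-assoc (count f m) _ _ ⟩
  count f m + (count (λ i → f (m + i)) n + toℕ (f (suc (m + n))))
    ≡⟨ cong (λ z → count f m + (count (λ i → f (m + i)) n + toℕ (f z))) (+-suc m n) ⟨
  count f m + count (λ i → f (m + i)) (suc n)
    ∎
  where open ≡-Reasoning

count-false : ∀ f n → (∀ k → suc k ≤ n → f (suc k) ≡ false) → count f n ≡ 0
count-false f zero    _   = refl
count-false f (suc n) off =
  cong₂ _+_ (count-false f n (λ k k<n → off k (m≤n⇒m≤1+n k<n))) (cong toℕ (off n ≤-refl))

count-multiples : ∀ p .{{_ : NonZero p}} (f : ℕ → Bool) M →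
                  count (λ k → does (p ∣? k) ∧ f k) (p * M) ≡ count (λ j → f (p * j)) M
count-multiples p@(suc q) f zero    = cong (count _) (*-zeroʳ p)
count-multiples p@(suc q) f (suc M) = begin
  count h (p * suc M)
    ≡⟨ cong (count h) p[1+M]≡pM+p ⟩
  count h (p * M + p)
    ≡⟨ count-+ h (p * M) p ⟩
  count h (p * M) + count (λ i → h (p * M + i)) p
    ≡⟨ cong₂ _+_ (count-multiples p f M) (block (p * M) (m∣m*n M)) ⟩
  count (λ j → f (p * j)) M + toℕ (f (p * M + p))
    ≡⟨ cong (λ z → count (λ j → f (p * j)) M + toℕ (f z)) p[1+M]≡pM+p ⟨
  count (λ j → f (p * j)) (suc M)
    ∎
  where
  open ≡-Reasoning
  h : ℕ → Bool
  h k = does (p ∣? k) ∧ f k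
  p[1+M]≡pM+p : p * suc M ≡ p * M + p
  p[1+M]≡pM+p = trans (*-suc p M) (+-comm p (p * M))
  -- among c+1, …, c+p only c+p is a multiple of p
  block : ∀ c → p ∣ c → count (λ i → h (c + i)) p ≡ toℕ (f (c + p))
  block c p∣c = cong₂ _+_ inner
    (cong (λ b → toℕ (b ∧ f (c + p))) (dec-true (p ∣? (c + p)) (∣m∣n⇒∣m+n p∣c ∣-refl)))
    where
    inner : count (λ i → h (c + i)) q ≡ 0
    inner = count-false _ q λ k k<q → cong (_∧ f (c + suc k))
      (dec-false (p ∣? (c + suc k)) (λ p∣ → <⇒≱ (s≤s k<q) (∣⇒≤ (∣m+n∣m⇒∣n p∣ p∣c))))

prime∤⇒coprime : ∀ {p m} → Prime p → ¬ p ∣ m → Coprime p m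
prime∤⇒coprime pr p∤m (i∣p , i∣m) with prime⇒irreducible pr i∣p
... | inj₁ i≡1 = i≡1
... | inj₂ refl = ⊥-elim (p∤m i∣m)

≢-primes⇒coprime : ∀ {p q} → Prime p → Prime q → p ≢ q → Coprime p q
≢-primes⇒coprime pr qr p≢q = prime∤⇒coprime pr λ p∣q → case prime⇒irreducible qr p∣q of λ where
  (inj₁ p≡1) → nonTrivial⇒≢1 {{prime⇒nonTrivial pr}} p≡1
  (inj₂ p≡q) → p≢q p≡q

prime⇒∸1≢0 : ∀ {p} → Prime p → NonZero (p ∸ 1)
prime⇒∸1≢0 {p} pr with nonTrivial⇒n>1 p {{prime⇒nonTrivial pr}}
... | s≤s (s≤s _) = _

coprime⇒*∣ : ∀ {a b n} → Coprime a b → a ∣ n → b ∣ n → a * b ∣ n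
coprime⇒*∣ {a} {b} c a∣n (divides j refl) =
  *-monoˡ-∣ b (coprime-divisor c (subst (a ∣_) (*-comm j b) a∣n))

product-∣ : ∀ {n} P → Unique P → All Prime P → All (_∣ n) P → product P ∣ n
product-∣ []      []              []          []          = 1∣ _
product-∣ (p ∷ P) (p∉P ∷ unique) (pr ∷ prs) (p∣n ∷ P∣n) =
  coprime⇒*∣ (prime∤⇒coprime pr p∤∏P) p∣n (product-∣ P unique prs P∣n)
  where
  p∤∏P : ¬ p ∣ product P
  p∤∏P p∣∏P = All.lookup p∉P (factorisationHasAllPrimeFactors pr p∣∏P prs) refl

noneDivides : List ℕ → ℕ → Bool
noneDivides P k = does (all? (λ p → ¬? (p ∣? k)) P)

noneDivides-*ˡ : ∀ {p} P → Prime p → All Prime P → All (p ≢_) P →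
                 ∀ j → noneDivides P (p * j) ≡ noneDivides P j
noneDivides-*ˡ []      _  _          _            j = refl
noneDivides-*ˡ {p} (q ∷ P) pr (qr ∷ prs) (p≢q ∷ p≢P) j =
  cong₂ (λ a b → not a ∧ b) (does-⇔ q∣p*j⇔q∣j (q ∣? (p * j)) (q ∣? j))
                            (noneDivides-*ˡ P pr prs p≢P j)
  where
  q∣p*j⇔q∣j = mk⇔ (coprime-divisor (≢-primes⇒coprime qr pr (p≢q ∘ sym)))
                  (λ q∣j → ∣-trans q∣j (n∣m*n p))

[p∸1]*m+m≡p*m : ∀ p .{{_ : NonZero p}} m → (p ∸ 1) * m + m ≡ p * m
[p∸1]*m+m≡p*m (suc q) m = +-comm (q * m) m

sieve : ∀ P → Unique P → All Prime P → ∀ M →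
        count (noneDivides P) (M * product P) ≡ M * product (map (_∸ 1) P)
sieve []      []             []         M = begin
  count (λ _ → true) (M * 1)  ≡⟨ cong (count _) (*-identityʳ M) ⟩
  count (λ _ → true) M        ≡⟨ count-true M ⟩
  M                           ≡⟨ *-identityʳ M ⟨
  M * 1                       ∎
  where open ≡-Reasoning
sieve (p ∷ P) (p∉P ∷ unique) (pr ∷ prs) M = +-cancelʳ-≡ (M * R) _ _ (begin
  sieved + M * R                           ≡⟨ cong (λ m → sieved + m) multiples ⟩
  sieved + count (λ k → divp k ∧ f k) n    ≡⟨ count-split divp f n ⟨
  count f n                                ≡⟨ cong (count f) (x∙yz≈yx∙z M p (product P)) ⟩
  count f (p * M * product P)              ≡⟨ sieve P unique prs (p * M) ⟩
  p * M * R                                ≡⟨ *-assoc p M R ⟩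
  p * (M * R)                              ≡⟨ [p∸1]*m+m≡p*m p (M * R) ⟨
  (p ∸ 1) * (M * R) + M * R                ≡⟨ cong (_+ M * R) (x∙yz≈y∙xz (p ∸ 1) M R) ⟩
  M * ((p ∸ 1) * R) + M * R                ∎)
  where
  open ≡-Reasoning
  instance _ = prime⇒nonZero pr
  f = noneDivides P
  divp : ℕ → Bool
  divp k = does (p ∣? k)
  R = product (map (_∸ 1) P)
  n = M * (p * product P)
  sieved = count (λ k → not (divp k) ∧ f k) n
  multiples : M * R ≡ count (λ k → divp k ∧ f k) n
  multiples = sym (begin
    count (λ k → divp k ∧ f k) n                      ≡⟨ cong (count _) (x∙yz≈y∙xz M p (product P)) ⟩
    count (λ k → divp k ∧ f k) (p * (M * product P))  ≡⟨ count-multiples p f (M * product P) ⟩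
    count (λ j → f (p * j)) (M * product P)           ≡⟨ count-cong (M * product P) (noneDivides-*ˡ P pr prs p∉P) ⟩
    count f (M * product P)                           ≡⟨ sieve P unique prs M ⟩
    M * R                                             ∎)

length-filter-1…n : ∀ {P : Pred ℕ 0ℓ} (P? : Decidable P) n →
                    length (filter P? (map suc (upTo n))) ≡ count (λ k → does (P? k)) n
length-filter-1…n P? zero    = refl
length-filter-1…n P? (suc n) = begin
  length (filter P? (map suc (upTo (suc n))))
    ≡⟨ cong (λ l → length (filter P? (map suc l))) (upTo-∷ʳ n) ⟨
  length (filter P? (map suc (upTo n ∷ʳ n)))
    ≡⟨ cong (λ l → length (filter P? l)) (map-++ suc (upTo n) [ n ]) ⟩
  length (filter P? (map suc (upTo n) ++ [ suc n ]))
    ≡⟨ cong length (filter-++ P? (map suc (upTo n)) [ suc n ]) ⟩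
  length (filter P? (map suc (upTo n)) ++ filter P? [ suc n ])
    ≡⟨ length-++ (filter P? (map suc (upTo n))) ⟩
  length (filter P? (map suc (upTo n))) + length (filter P? [ suc n ])
    ≡⟨ cong₂ _+_ (length-filter-1…n P? n) (length-filter-[] (suc n)) ⟩
  count (λ k → does (P? k)) (suc n)
    ∎
  where
  open ≡-Reasoning
  length-filter-[] : ∀ x → length (filter P? [ x ]) ≡ toℕ (does (P? x))
  length-filter-[] x with does (P? x)
  ... | true  = refl
  ... | false = refl

W-primeDivisors : ∀ x → All (λ p → Prime p × p ∣ x) (W x)
W-primeDivisors x = all-filter (λ p → prime? p ×-dec (p ∣? x)) (upTo (suc x))

W-unique : ∀ x → Unique (W x)
W-unique x = Unique.filter⁺ (λ p → prime? p ×-dec (p ∣? x)) (Unique.upTo⁺ (suc x))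

W-primes : ∀ x → All Prime (W x)
W-primes x = All.map proj₁ (W-primeDivisors x)

∈-W : ∀ {x p} .{{_ : NonZero x}} → Prime p → p ∣ x → p ∈ W x
∈-W {x} pr p∣x = ∈-filter⁺ (λ p → prime? p ×-dec (p ∣? x)) (∈-upTo⁺ (s≤s (∣⇒≤ p∣x))) (pr , p∣x)

∃-prime-∣ : ∀ d → 2 ≤ d → ∃ λ p → Prime p × p ∣ d
∃-prime-∣ d (s≤s (s≤s _)) with factorise d
... | record { factors = [] ; isFactorisation = () }
... | record { factors = p ∷ ps ; isFactorisation = d≡∏ ; factorsPrime = pr ∷ _ } =
  p , pr , subst (p ∣_) (sym d≡∏) (m∣m*n (product ps))

does-coprime?≡noneDivides : ∀ n .{{_ : NonZero n}} k → does (coprime? k n) ≡ noneDivides (W n) k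
does-coprime?≡noneDivides n k = does-⇔ (mk⇔ to from) (coprime? k n) (all? (λ p → ¬? (p ∣? k)) (W n))
  where
  to : Coprime k n → All (λ p → ¬ p ∣ k) (W n)
  to k⊥n = All.map (λ (pr , p∣n) p∣k → nonTrivial⇒≢1 {{prime⇒nonTrivial pr}} (k⊥n (p∣k , p∣n)))
                   (W-primeDivisors n)
  from : All (λ p → ¬ p ∣ k) (W n) → Coprime k n
  from _     {zero}          (_ , 0∣n) = ⊥-elim (≢-nonZero⁻¹ n (0∣⇒≡0 0∣n))
  from _     {suc zero}      _         = refl
  from W∤k {i@(suc (suc _))} (i∣k , i∣n) with ∃-prime-∣ i (s≤s (s≤s z≤n))
  ... | p , pr , p∣i = ⊥-elim (All.lookup W∤k (∈-W pr (∣-trans p∣i i∣n)) (∣-trans p∣i i∣k))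

φ-product : ∀ n .{{_ : NonZero n}} → φ n * product (W n) ≡ n * product (map (_∸ 1) (W n))
φ-product n with product-∣ (W n) (W-unique n) (W-primes n) (All.map proj₂ (W-primeDivisors n))
... | divides M n≡M*∏W = begin
  φ n * ∏W                                 ≡⟨ cong (_* ∏W) (length-filter-1…n (λ k → coprime? k n) n) ⟩
  count (λ k → does (coprime? k n)) n * ∏W  ≡⟨ cong (_* ∏W) (count-cong n (does-coprime?≡noneDivides n)) ⟩
  count (noneDivides (W n)) n * ∏W         ≡⟨ cong (λ m → count (noneDivides (W n)) m * ∏W) n≡M*∏W ⟩
  count (noneDivides (W n)) (M * ∏W) * ∏W  ≡⟨ cong (_* ∏W) (sieve (W n) (W-unique n) (W-primes n) M) ⟩
  M * ∏[p∸1] * ∏W                          ≡⟨ xy∙z≈xz∙y M ∏[p∸1] ∏W ⟩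
  M * ∏W * ∏[p∸1]                          ≡⟨ cong (_* ∏[p∸1]) n≡M*∏W ⟨
  n * ∏[p∸1]                               ∎
  where
  open ≡-Reasoning
  ∏W = product (W n)
  ∏[p∸1] = product (map (_∸ 1) (W n))

toℚᵘ-frac : ∀ a b .{{_ : NonZero b}} → toℚᵘ (frac a b) ≃ + a / b
toℚᵘ-frac a (suc b) = toℚᵘ-fromℚᵘ (mkℚᵘ (+ a) b)

/-homo-* : ∀ a b c d .{{_ : NonZero b}} .{{_ : NonZero d}} →
           (+ a / b) ℚᵘ.* (+ c / d) ≃ (+ (a * c) / (b * d)) {{m*n≢0 b d}}
/-homo-* a (suc b) c (suc d) = ≃-reflexive (cong (λ z → mkℚᵘ z _) (sym (pos-* a c)))

m/n<1 : ∀ {m n} .{{_ : NonZero n}} → m < n → + m / n ℚᵘ.< ℚᵘ.1ℚᵘ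
m/n<1 {m} {suc n} m<n =
  *<* (subst₂ ℤ._<_ (sym (ℤ.*-identityʳ (+ m))) (sym (ℤ.*-identityˡ (+ suc n))) (+<+ m<n))

toℚᵘ-prodA : ∀ {L} (nz : All NonZero L) →
             toℚᵘ (prodA L) ≃ (+ product (map (_∸ 1) L) / product L) {{product≢0 nz}}
toℚᵘ-prodA {[]}    []         = ≃-refl
toℚᵘ-prodA {q ∷ L} (q≢0 ∷ nz) = begin
  toℚᵘ (frac (q ∸ 1) q ℚ.* prodA L)                             ≈⟨ toℚᵘ-homo-* (frac (q ∸ 1) q) (prodA L) ⟩
  toℚᵘ (frac (q ∸ 1) q) ℚᵘ.* toℚᵘ (prodA L)                     ≈⟨ ℚᵘ.*-cong (toℚᵘ-frac (q ∸ 1) q) (toℚᵘ-prodA nz) ⟩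
  (+ (q ∸ 1) / q) ℚᵘ.* (+ product (map (_∸ 1) L) / product L)  ≈⟨ /-homo-* (q ∸ 1) q _ (product L) ⟩
  + ((q ∸ 1) * product (map (_∸ 1) L)) / (q * product L)        ∎
  where
  open ℚᵘ.≃-Reasoning
  instance
    _ = q≢0
    _ = product≢0 nz
    _ = m*n≢0 q (product L)

toℚᵘ-prodB : ∀ {L} (nz : All (λ q → NonZero (q ∸ 1)) L) →
             toℚᵘ (prodB L) ≃ (+ product L / product (map (_∸ 1) L)) {{product≢0 (map⁺ nz)}}
toℚᵘ-prodB {[]}    []          = ≃-refl
toℚᵘ-prodB {q ∷ L} (q∸1≢0 ∷ nz) = begin
  toℚᵘ (frac q (q ∸ 1) ℚ.* prodB L)                             ≈⟨ toℚᵘ-homo-* (frac q (q ∸ 1)) (prodB L) ⟩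
  toℚᵘ (frac q (q ∸ 1)) ℚᵘ.* toℚᵘ (prodB L)                     ≈⟨ ℚᵘ.*-cong (toℚᵘ-frac q (q ∸ 1)) (toℚᵘ-prodB nz) ⟩
  (+ q / (q ∸ 1)) ℚᵘ.* (+ product L / product (map (_∸ 1) L))  ≈⟨ /-homo-* q (q ∸ 1) (product L) _ ⟩
  + (q * product L) / ((q ∸ 1) * product (map (_∸ 1) L))        ∎
  where
  open ℚᵘ.≃-Reasoning
  instance
    _ = q∸1≢0
    _ = product≢0 (map⁺ nz)
    _ = m*n≢0 (q ∸ 1) (product (map (_∸ 1) L))

totient-cross-< : ∀ x y .{{_ : NonZero x}} .{{_ : NonZero y}} → φ y ≤ φ x → x < y →
                  product (map (_∸ 1) (W y)) * product (W x) < product (W y) * product (map (_∸ 1) (W x))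
totient-cross-< x y φy≤φx x<y = *-cancelˡ-< y _ _ (begin-strict
  y * (Ay * Bx)  ≡⟨ *-assoc y Ay Bx ⟨
  y * Ay * Bx    ≡⟨ cong (_* Bx) (φ-product y) ⟨
  φ y * By * Bx  ≤⟨ *-monoˡ-≤ Bx (*-monoˡ-≤ By φy≤φx) ⟩
  φ x * By * Bx  ≡⟨ xy∙z≈xz∙y (φ x) By Bx ⟩
  φ x * Bx * By  ≡⟨ cong (_* By) (φ-product x) ⟩
  x * Ax * By    ≡⟨ xy∙z≈x∙zy x Ax By ⟩
  x * (By * Ax)  <⟨ *-monoˡ-< (By * Ax) x<y ⟩
  y * (By * Ax)  ∎)
  where
  open ≤-Reasoning
  Ax = product (map (_∸ 1) (W x))
  Ay = product (map (_∸ 1) (W y))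
  Bx = product (W x)
  By = product (W y)
  instance
    _ = productOfPrimes≢0 (W-primes y)
    _ = product≢0 (map⁺ (All.map prime⇒∸1≢0 (W-primes x)))
    _ = m*n≢0 By Ax

D<1 : ∀ {A B} → All NonZero A → All (λ q → NonZero (q ∸ 1)) B →
      product (map (_∸ 1) A) * product B < product A * product (map (_∸ 1) B) → D A B <ℚ 1ℚ
D<1 {A} {B} nzA nzB cross = toℚᵘ-cancel-< (<-respˡ-≃ (≃-sym D≃) (m/n<1 cross))
  where
  instance
    _ = product≢0 nzA
    _ = product≢0 (map⁺ nzB)
    _ = m*n≢0 (product A) (product (map (_∸ 1) B))
  D≃ : toℚᵘ (D A B) ≃ + (product (map (_∸ 1) A) * product B) / (product A * product (map (_∸ 1) B))
  D≃ = ≃-trans (toℚᵘ-homo-* (prodA A) (prodB B))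
         (≃-trans (ℚᵘ.*-cong (toℚᵘ-prodA nzA) (toℚᵘ-prodB nzB))
                  (/-homo-* (product (map (_∸ 1) A)) (product A) (product B) (product (map (_∸ 1) B))))

lemma3p6 : (x y : ℕ) → 2 ≤ x → 2 ≤ y → φ y ≤ φ x → x < y → D (W y) (W x) <ℚ 1ℚ
lemma3p6 x y 2≤x 2≤y φy≤φx x<y =
  D<1 (All.map prime⇒nonZero (W-primes y)) (All.map prime⇒∸1≢0 (W-primes x))
      (totient-cross-< x y φy≤φx x<y)
  where
  instance
    _ = >-nonZero (<-trans z<s 2≤x)
    _ = >-nonZero (<-trans z<s 2≤y)
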